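{- Let $H$ be a simple finite graph (loops allowed) and $G$ a simple, finite, loopless graph with $n$ vertices. Then $$ \mathrm{hom}(G,H) = \sum_{S \subseteq E(G)} (-1)^{|S|}\,\mathrm{hom}(G(S),H^c)\,|V(H)|^{\,n-v(S)}, $$ where $v(S)$ is the number of vertices spanned by the edge set $S$, $G(S)$ is the subgraph of $G$ spanned by $S$ (vertex set: the endpoints of edges in $S$; edge set $S$), and $H^c$ is the complement of $H$ with all isolated vertices removed.
   Context: For graphs $G$ and $H$ (with $H$ possibly having loops), $\mathrm{hom}(G,H)$ denotes the number of maps $f:V(G)\to V(H)$ such that $uv\in E(G)$ implies $f(u)f(v)\in E(H)$ (a loop at $w$ means $ww\in E(H)$). The complement $H^c$ of $H$ is taken with respect to the complete looped graph on $V(H)$: for (not necessarily distinct) $u,v\in V(H)$, $uv\in E(H^c)$ iff $uv\notin E(H)$; then isolated vertices are removed. For $S=\emptyset$, $G(S)$ is the empty graph and $\mathrm{hom}(G(\emptyset),H^c)=1$. -}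

module Defs where

open import Data.Bool using (Bool; true; false; not; _∧_; _∨_; if_then_else_)
open import Data.Nat using (ℕ; zero; suc; _∸_; _<ᵇ_)
open import Data.Fin using (Fin; toℕ)
open import Data.Fin.Properties using (_≟_)
open import Data.List using (List; []; _∷_; [_]; map; concatMap; length; lookup; filterᵇ; allFin)
open import Data.Bool.ListAction using (all; any)
open import Data.Product using (_×_; _,_; proj₁; proj₂)
open import Data.Integer as ℤ using (ℤ; +_; -_)
open import Relation.Nullary.Decidable using (⌊_⌋)
open import Relation.Binary.PropositionalEquality using (_≡_)

record Graph : Set where
  field
    V   : ℕ
    adj : Fin V → Fin V → Bool
open Graph public

Symmetric : Graph → Set
Symmetric G = ∀ u v → adj G u v ≡ adj G v u

Loopless : Graph → Set
Loopless G = ∀ v → adj G v v ≡ false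

consF : ∀ {n m} → Fin m → (Fin n → Fin m) → (Fin (suc n) → Fin m)
consF c f Fin.zero = c
consF c f (Fin.suc i) = f i

allFuns : (n m : ℕ) → List (Fin n → Fin m)
allFuns zero m = [ (λ ()) ]
allFuns (suc n) m = concatMap (λ f → map (λ c → consF c f) (allFin m)) (allFuns n m)

count : ∀ {A : Set} → (A → Bool) → List A → ℕ
count p [] = 0
count p (x ∷ xs) = if p x then suc (count p xs) else count p xs

isHom : (G H : Graph) → (Fin (V G) → Fin (V H)) → Bool
isHom G H f = all (λ u → all (λ v → not (adj G u v) ∨ adj H (f u) (f v)) (allFin (V G))) (allFin (V G))

hom : Graph → Graph → ℕ
hom G H = count (isHom G H) (allFuns (V G) (V H))

infixl 5 _≈ᶠ_
_≈ᶠ_ : ∀ {n} → Fin n → Fin n → Bool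
a ≈ᶠ b = ⌊ a ≟ b ⌋

onVertices : (n : ℕ) → (Fin n → Fin n → Bool) → List (Fin n) → Graph
onVertices n a vs = record { V = length vs ; adj = λ i j → a (lookup vs i) (lookup vs j) }

edges : (G : Graph) → List (Fin (V G) × Fin (V G))
edges G = concatMap (λ u → map (λ v → (u , v))
            (filterᵇ (λ v → (toℕ u <ᵇ toℕ v) ∧ adj G u v) (allFin (V G)))) (allFin (V G))

subsets : ∀ {A : Set} → List A → List (List A)
subsets [] = [ [] ]
subsets (x ∷ xs) = subsets xs Data.List.++ map (x ∷_) (subsets xs)

inEdges : ∀ {n} → List (Fin n × Fin n) → Fin n → Fin n → Bool
inEdges S u v = any (λ e → ((proj₁ e ≈ᶠ u) ∧ (proj₂ e ≈ᶠ v)) ∨ ((proj₁ e ≈ᶠ v) ∧ (proj₂ e ≈ᶠ u))) S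

spanned : ∀ {n} → List (Fin n × Fin n) → List (Fin n)
spanned {n} S = filterᵇ (λ x → any (λ e → (proj₁ e ≈ᶠ x) ∨ (proj₂ e ≈ᶠ x)) S) (allFin n)

GS : (G : Graph) → List (Fin (V G) × Fin (V G)) → Graph
GS G S = onVertices (V G) (inEdges S) (spanned S)

vS : (G : Graph) → List (Fin (V G) × Fin (V G)) → ℕ
vS G S = length (spanned S)

-- H^c: complement w.r.t. the complete looped graph, isolated vertices removed
Hc : Graph → Graph
Hc H = onVertices (V H) (λ u v → not (adj H u v))
         (filterᵇ (λ w → any (λ u → not (adj H w u)) (allFin (V H))) (allFin (V H)))

sumℤ : List ℤ → ℤ
sumℤ [] = + 0
sumℤ (x ∷ xs) = x ℤ.+ sumℤ xs

-- Write [f is a homomorphism] as the product over the edges e of G of (1 − [f maps e to a non-edge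
-- of H]) and expand: the term of S ⊆ E(G) is (−1)^|S| times the number of maps sending every edge of S
-- to an edge of the looped complement of H, i.e. of homomorphisms from (V(G), S) into that complement.
-- Vertices not spanned by S are unconstrained, giving the factor |V(H)|^(n − v(S)); every vertex of
-- G(S) has a neighbour, so it is never mapped to an isolated vertex of the complement, and those
-- vertices can be deleted.

module Submission where

open import Defs
open import Data.Nat using (ℕ; _∸_; _^_)
open import Data.List using (List; map; length)
open import Data.Integer using (ℤ; +_; -_; _*_) renaming (_^_ to _^ℤ_)
open import Relation.Binary.PropositionalEquality using (_≡_)

open import Data.Bool using (Bool; true; false; not; _∧_; _∨_; T; T?)
open import Data.Bool.ListAction using (all; any)
open import Data.Bool.Properties using (T-≡; T-∧; T-∨; ⇔→≡)
open import Data.Empty using (⊥-elim)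
open import Data.Fin using (Fin; zero; suc; toℕ)
open import Data.Fin.Properties using (<-cmp)
open import Data.Integer using (_+_; _-_; -1ℤ)
import Data.Integer.Properties as ℤ
open import Algebra.Properties.CommutativeSemigroup ℤ.+-commutativeSemigroup using (interchange)
open import Data.List using ([]; _∷_; _++_; concatMap; filterᵇ; tabulate; lookup; allFin)
open import Data.List.Membership.Propositional using (_∈_; find; lose)
open import Data.List.Membership.Propositional.Properties
  using (∈-allFin; ∈-lookup; ∈-filter⁺; ∈-filter⁻; ∈-map⁺; ∈-map⁻; ∈-concatMap⁺; ∈-concatMap⁻)
open import Data.List.Properties using (map-∘; map-cong; map-tabulate; tabulate-lookup; length-tabulate)
import Data.List.Relation.Unary.All as All
open import Data.List.Relation.Unary.All.Properties using (all⁺; all⁻)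
import Data.List.Relation.Unary.Any as Any
open import Data.List.Relation.Unary.Any.Properties using (any⁺; any⁻; any⇔; lookup-index; Any-⊎⁺; Any-⊎⁻)
open import Data.Nat using (zero; suc; _≤_; _<_; _<ᵇ_; z≤n; s≤s) renaming (_*_ to _*ℕ_)
import Data.Nat.Properties as ℕ
open import Data.Product using (Σ; ∃; _×_; _,_; proj₁; proj₂; swap)
open import Data.Sum using (_⊎_; inj₁; inj₂)
import Data.Sum as Sum
open import Function using (_∘_)
open import Function.Bundles using (_⇔_; mk⇔; Equivalence)
import Function.Properties.Equivalence as ⇔
open import Relation.Binary using (tri<; tri≈; tri>)
open import Relation.Binary.PropositionalEquality
  using (refl; sym; trans; cong; cong₂; subst; subst₂; _≗_; module ≡-Reasoning)
open import Relation.Nullary using (¬_)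
open import Relation.Nullary.Decidable using (toWitness; fromWitness)

open Equivalence using (to; from)

∑ : {A : Set} → List A → (A → ℤ) → ℤ
∑ xs g = sumℤ (map g xs)

module _ {A : Set} where

  ∑-++ : (xs ys : List A) (g : A → ℤ) → ∑ (xs ++ ys) g ≡ ∑ xs g + ∑ ys g
  ∑-++ []       ys g = sym (ℤ.+-identityˡ (∑ ys g))
  ∑-++ (x ∷ xs) ys g = trans (cong (_+_ (g x)) (∑-++ xs ys g)) (sym (ℤ.+-assoc (g x) _ _))

  ∑-cong : (xs : List A) {g g′ : A → ℤ} → g ≗ g′ → ∑ xs g ≡ ∑ xs g′
  ∑-cong xs g≗g′ = cong sumℤ (map-cong g≗g′ xs)

  ∑-map : ∀ {B : Set} (h : B → A) (xs : List B) (g : A → ℤ) → ∑ (map h xs) g ≡ ∑ xs (g ∘ h)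
  ∑-map h xs g = cong sumℤ (sym (map-∘ xs))

  ∑-concatMap : ∀ {B : Set} (h : B → List A) (xs : List B) (g : A → ℤ) →
    ∑ (concatMap h xs) g ≡ ∑ xs (λ x → ∑ (h x) g)
  ∑-concatMap h []       g = refl
  ∑-concatMap h (x ∷ xs) g =
    trans (∑-++ (h x) (concatMap h xs) g) (cong (_+_ (∑ (h x) g)) (∑-concatMap h xs g))

  ∑-0 : (xs : List A) → ∑ xs (λ _ → + 0) ≡ + 0
  ∑-0 []       = refl
  ∑-0 (x ∷ xs) = trans (ℤ.+-identityˡ _) (∑-0 xs)

  ∑-+ : (xs : List A) (g g′ : A → ℤ) → ∑ xs (λ x → g x + g′ x) ≡ ∑ xs g + ∑ xs g′
  ∑-+ []       g g′ = refl
  ∑-+ (x ∷ xs) g g′ = trans (cong (_+_ (g x + g′ x)) (∑-+ xs g g′)) (interchange (g x) (g′ x) _ _)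

  ∑-*ˡ : (xs : List A) (a : ℤ) (g : A → ℤ) → ∑ xs (λ x → a * g x) ≡ a * ∑ xs g
  ∑-*ˡ []       a g = sym (ℤ.*-zeroʳ a)
  ∑-*ˡ (x ∷ xs) a g = trans (cong (_+_ (a * g x)) (∑-*ˡ xs a g)) (sym (ℤ.*-distribˡ-+ a (g x) _))

  ∑-const : (xs : List A) (a : ℤ) → ∑ xs (λ _ → a) ≡ + length xs * a
  ∑-const []       a = refl
  ∑-const (x ∷ xs) a = begin
    a + ∑ xs (λ _ → a)            ≡⟨ cong (_+_ a) (∑-const xs a) ⟩
    a + + length xs * a           ≡⟨ cong (λ b → b + + length xs * a) (sym (ℤ.*-identityˡ a)) ⟩
    + 1 * a + + length xs * a     ≡⟨ sym (ℤ.*-distribʳ-+ a (+ 1) (+ length xs)) ⟩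
    + length (x ∷ xs) * a         ∎
    where open ≡-Reasoning

  ∑-filter : (t : A → Bool) (xs : List A) (g : A → ℤ) → (∀ x → t x ≡ false → g x ≡ + 0) →
    ∑ (filterᵇ t xs) g ≡ ∑ xs g
  ∑-filter t []       g g-off = refl
  ∑-filter t (x ∷ xs) g g-off with t x in tx
  ... | true  = cong (_+_ (g x)) (∑-filter t xs g g-off)
  ... | false = trans (∑-filter t xs g g-off)
                  (sym (trans (cong (λ b → b + ∑ xs g) (g-off x tx)) (ℤ.+-identityˡ (∑ xs g))))

  ∑-lookup : (xs : List A) (g : A → ℤ) → ∑ (allFin (length xs)) (g ∘ lookup xs) ≡ ∑ xs g
  ∑-lookup xs g = begin
    ∑ (allFin (length xs)) (g ∘ lookup xs) ≡⟨ cong sumℤ (map-tabulate (λ i → i) (g ∘ lookup xs)) ⟩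
    sumℤ (tabulate (g ∘ lookup xs))        ≡⟨ cong sumℤ (sym (map-tabulate (lookup xs) g)) ⟩
    ∑ (tabulate (lookup xs)) g             ≡⟨ cong (λ ys → ∑ ys g) (tabulate-lookup xs) ⟩
    ∑ xs g                                 ∎
    where open ≡-Reasoning

∑-swap : ∀ {A B : Set} (xs : List A) (ys : List B) (g : A → B → ℤ) →
  ∑ xs (λ x → ∑ ys (g x)) ≡ ∑ ys (λ y → ∑ xs (λ x → g x y))
∑-swap []       ys g = sym (∑-0 ys)
∑-swap (x ∷ xs) ys g =
  trans (cong (_+_ (∑ ys (g x))) (∑-swap xs ys g)) (sym (∑-+ ys (g x) (λ y → ∑ xs (λ x′ → g x′ y))))

∑-allFin-const : (m : ℕ) (a : ℤ) → ∑ (allFin m) (λ _ → a) ≡ + m * a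
∑-allFin-const m a = trans (∑-const (allFin m) a) (cong (λ k → + k * a) (length-tabulate {n = m} (λ i → i)))

⟦_⟧ : Bool → ℤ
⟦ true  ⟧ = + 1
⟦ false ⟧ = + 0

count≡∑ : ∀ {A : Set} (p : A → Bool) (xs : List A) → + count p xs ≡ ∑ xs (λ x → ⟦ p x ⟧)
count≡∑ p []       = refl
count≡∑ p (x ∷ xs) with p x
... | true  = cong (_+_ (+ 1)) (count≡∑ p xs)
... | false = trans (count≡∑ p xs) (sym (ℤ.+-identityˡ _))

⟦⟧-false : ∀ {b} → ¬ T b → ⟦ b ⟧ ≡ + 0
⟦⟧-false {true}  ¬b = ⊥-elim (¬b _)
⟦⟧-false {false} ¬b = refl

∑-subsets-∷ : ∀ {A : Set} (x : A) (xs : List A) (g : List A → ℤ) →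
  ∑ (subsets (x ∷ xs)) g ≡ ∑ (subsets xs) g + ∑ (subsets xs) (g ∘ (x ∷_))
∑-subsets-∷ x xs g =
  trans (∑-++ (subsets xs) (map (x ∷_) (subsets xs)) g)
        (cong (_+_ (∑ (subsets xs) g)) (∑-map (x ∷_) (subsets xs) g))

sign : ∀ {A : Set} → List A → ℤ
sign S = (- (+ 1)) ^ℤ length S

module InclusionExclusion {A : Set} (q : A → Bool) where

  term : List A → ℤ
  term S = sign S * ⟦ all (not ∘ q) S ⟧

  ∑-term-∷-true : ∀ {x} → q x ≡ true → (xs : List A) → ∑ (subsets xs) (term ∘ (x ∷_)) ≡ + 0
  ∑-term-∷-true {x} qx xs = trans (∑-cong (subsets xs) term-∷≡0) (∑-0 (subsets xs))
    where
    term-∷≡0 : ∀ S → term (x ∷ S) ≡ + 0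
    term-∷≡0 S = trans (cong (λ b → sign (x ∷ S) * ⟦ not b ∧ all (not ∘ q) S ⟧) qx)
                       (ℤ.*-zeroʳ (sign (x ∷ S)))

  ∑-term-∷-false : ∀ {x} → q x ≡ false → (xs : List A) →
    ∑ (subsets xs) (term ∘ (x ∷_)) ≡ - ∑ (subsets xs) term
  ∑-term-∷-false {x} qx xs = begin
    ∑ (subsets xs) (term ∘ (x ∷_))        ≡⟨ ∑-cong (subsets xs) term-∷≡-term ⟩
    ∑ (subsets xs) (λ S → -1ℤ * term S)   ≡⟨ ∑-*ˡ (subsets xs) -1ℤ term ⟩
    -1ℤ * ∑ (subsets xs) term             ≡⟨ ℤ.-1*i≡-i _ ⟩
    - ∑ (subsets xs) term                 ∎
    where
    open ≡-Reasoning
    term-∷≡-term : ∀ S → term (x ∷ S) ≡ -1ℤ * term S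
    term-∷≡-term S = trans (cong (λ b → sign (x ∷ S) * ⟦ not b ∧ all (not ∘ q) S ⟧) qx)
                           (ℤ.*-assoc -1ℤ (sign S) _)

  all≡∑-subsets : (xs : List A) → ⟦ all q xs ⟧ ≡ ∑ (subsets xs) term
  all≡∑-subsets []       = refl
  all≡∑-subsets (x ∷ xs) with q x in qx
  ... | true = begin
    ⟦ all q xs ⟧                                          ≡⟨ all≡∑-subsets xs ⟩
    ∑ (subsets xs) term                                   ≡⟨ sym (ℤ.+-identityʳ (∑ (subsets xs) term)) ⟩
    ∑ (subsets xs) term + + 0                             ≡⟨ cong (_+_ (∑ (subsets xs) term)) (sym (∑-term-∷-true qx xs)) ⟩
    ∑ (subsets xs) term + ∑ (subsets xs) (term ∘ (x ∷_))  ≡⟨ sym (∑-subsets-∷ x xs term) ⟩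
    ∑ (subsets (x ∷ xs)) term                             ∎
    where open ≡-Reasoning
  ... | false = begin
    + 0                                                   ≡⟨ sym (ℤ.+-inverseʳ (∑ (subsets xs) term)) ⟩
    ∑ (subsets xs) term - ∑ (subsets xs) term             ≡⟨ cong (_+_ (∑ (subsets xs) term)) (sym (∑-term-∷-false qx xs)) ⟩
    ∑ (subsets xs) term + ∑ (subsets xs) (term ∘ (x ∷_))  ≡⟨ sym (∑-subsets-∷ x xs term) ⟩
    ∑ (subsets (x ∷ xs)) term                             ∎
    where open ≡-Reasoning

∑-allFuns-suc : ∀ n m (F : (Fin (suc n) → Fin m) → ℤ) →
  ∑ (allFuns (suc n) m) F ≡ ∑ (allFin m) (λ c → ∑ (allFuns n m) (F ∘ consF c))
∑-allFuns-suc n m F = begin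
  ∑ (allFuns (suc n) m) F                                 ≡⟨ ∑-concatMap _ (allFuns n m) F ⟩
  ∑ (allFuns n m) (λ f → ∑ (map (λ c → consF c f) (allFin m)) F)
    ≡⟨ ∑-cong (allFuns n m) (λ f → ∑-map (λ c → consF c f) (allFin m) F) ⟩
  ∑ (allFuns n m) (λ f → ∑ (allFin m) (λ c → F (consF c f))) ≡⟨ ∑-swap (allFuns n m) (allFin m) _ ⟩
  ∑ (allFin m) (λ c → ∑ (allFuns n m) (F ∘ consF c))       ∎
  where open ≡-Reasoning

data Thinning : ℕ → ℕ → Set where
  done : Thinning 0 0
  skip : ∀ {k n} → Thinning k n → Thinning k (suc n)
  keep : ∀ {k n} → Thinning k n → Thinning (suc k) (suc n)

embed : ∀ {k n} → Thinning k n → Fin k → Fin n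
embed (skip ρ) i       = suc (embed ρ i)
embed (keep ρ) zero    = zero
embed (keep ρ) (suc i) = suc (embed ρ i)

thinning-≤ : ∀ {k n} → Thinning k n → k ≤ n
thinning-≤ done     = z≤n
thinning-≤ (skip ρ) = ℕ.m≤n⇒m≤1+n (thinning-≤ ρ)
thinning-≤ (keep ρ) = s≤s (thinning-≤ ρ)

filter-thinning : ∀ {A : Set} {n} (s : A → Bool) (g : Fin n → A) →
  Σ (Thinning (length (filterᵇ s (tabulate g))) n) λ ρ →
    ∀ i → lookup (filterᵇ s (tabulate g)) i ≡ g (embed ρ i)
filter-thinning {n = zero}  s g = done , λ ()
filter-thinning {n = suc n} s g with s (g zero) | filter-thinning s (g ∘ suc)
... | true  | ρ , eq = keep ρ , λ { zero → refl ; (suc i) → eq i }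
... | false | ρ , eq = skip ρ , eq

∑-allFuns-thin : ∀ {k n m} (ρ : Thinning k n) (F : (Fin n → Fin m) → ℤ) (F′ : (Fin k → Fin m) → ℤ) →
  (∀ f h → f ∘ embed ρ ≗ h → F f ≡ F′ h) →
  ∑ (allFuns n m) F ≡ + (m ^ (n ∸ k)) * ∑ (allFuns k m) F′
∑-allFuns-thin done F F′ F≡F′ =
  trans (cong (λ a → a + + 0) (F≡F′ (λ ()) (λ ()) (λ ()))) (sym (ℤ.*-identityˡ _))
∑-allFuns-thin {k} {suc n} {m} (skip ρ) F F′ F≡F′ = begin
  ∑ (allFuns (suc n) m) F                                 ≡⟨ ∑-allFuns-suc n m F ⟩
  ∑ (allFin m) (λ c → ∑ (allFuns n m) (F ∘ consF c))
    ≡⟨ ∑-cong (allFin m) (λ c → ∑-allFuns-thin ρ (F ∘ consF c) F′ (F≡F′ ∘ consF c)) ⟩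
  ∑ (allFin m) (λ _ → + (m ^ (n ∸ k)) * X)                ≡⟨ ∑-allFin-const m _ ⟩
  + m * (+ (m ^ (n ∸ k)) * X)                             ≡⟨ sym (ℤ.*-assoc (+ m) _ X) ⟩
  + m * + (m ^ (n ∸ k)) * X                               ≡⟨ cong (_* X) (sym (ℤ.pos-* m _)) ⟩
  + (m ^ suc (n ∸ k)) * X
    ≡⟨ cong (λ e → + (m ^ e) * X) (sym (ℕ.+-∸-assoc 1 (thinning-≤ ρ))) ⟩
  + (m ^ (suc n ∸ k)) * X                                 ∎
  where
  open ≡-Reasoning
  X = ∑ (allFuns k m) F′
∑-allFuns-thin {suc k} {suc n} {m} (keep ρ) F F′ F≡F′ = begin
  ∑ (allFuns (suc n) m) F                                 ≡⟨ ∑-allFuns-suc n m F ⟩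
  ∑ (allFin m) (λ c → ∑ (allFuns n m) (F ∘ consF c))
    ≡⟨ ∑-cong (allFin m) (λ c → ∑-allFuns-thin ρ (F ∘ consF c) (F′ ∘ consF c)
         (λ f h eq → F≡F′ (consF c f) (consF c h) λ { zero → refl ; (suc i) → eq i })) ⟩
  ∑ (allFin m) (λ c → + (m ^ (n ∸ k)) * ∑ (allFuns k m) (F′ ∘ consF c))
    ≡⟨ ∑-*ˡ (allFin m) (+ (m ^ (n ∸ k))) _ ⟩
  + (m ^ (n ∸ k)) * ∑ (allFin m) (λ c → ∑ (allFuns k m) (F′ ∘ consF c))
    ≡⟨ cong (_*_ (+ (m ^ (n ∸ k)))) (sym (∑-allFuns-suc k m F′)) ⟩
  + (m ^ (n ∸ k)) * ∑ (allFuns (suc k) m) F′              ∎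
  where open ≡-Reasoning

∑-allFuns-filter : ∀ k {m} (t : Fin m → Bool) (F : (Fin k → Fin m) → ℤ)
  (F′ : (Fin k → Fin (length (filterᵇ t (allFin m)))) → ℤ) →
  (∀ h i → t (h i) ≡ false → F h ≡ + 0) →
  (∀ h h′ → h ≗ lookup (filterᵇ t (allFin m)) ∘ h′ → F h ≡ F′ h′) →
  ∑ (allFuns k m) F ≡ ∑ (allFuns k (length (filterᵇ t (allFin m)))) F′
∑-allFuns-filter zero t F F′ F-off F≡F′ = cong (λ a → a + + 0) (F≡F′ (λ ()) (λ ()) (λ ()))
∑-allFuns-filter (suc k) {m} t F F′ F-off F≡F′ = begin
  ∑ (allFuns (suc k) m) F                                 ≡⟨ ∑-allFuns-suc k m F ⟩
  ∑ (allFin m) (λ c → ∑ (allFuns k m) (F ∘ consF c))      ≡⟨ sym (∑-filter t (allFin m) _ column-off) ⟩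
  ∑ L (λ c → ∑ (allFuns k m) (F ∘ consF c))               ≡⟨ sym (∑-lookup L _) ⟩
  ∑ (allFin k′) (λ j → ∑ (allFuns k m) (F ∘ consF (lookup L j)))
    ≡⟨ ∑-cong (allFin k′) (λ j → ∑-allFuns-filter k t (F ∘ consF (lookup L j)) (F′ ∘ consF j)
         (λ h i → F-off (consF (lookup L j) h) (suc i))
         (λ h h′ eq → F≡F′ (consF (lookup L j) h) (consF j h′) λ { zero → refl ; (suc i) → eq i })) ⟩
  ∑ (allFin k′) (λ j → ∑ (allFuns k k′) (F′ ∘ consF j))   ≡⟨ sym (∑-allFuns-suc k k′ F′) ⟩
  ∑ (allFuns (suc k) k′) F′                               ∎
  where
  open ≡-Reasoning
  L = filterᵇ t (allFin m)
  k′ = length L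
  column-off : ∀ c → t c ≡ false → ∑ (allFuns k m) (F ∘ consF c) ≡ + 0
  column-off c tc = trans (∑-cong (allFuns k m) (λ f → F-off (consF c f) zero tc)) (∑-0 (allFuns k m))

T-injective : ∀ {a b} → (T a ⇔ T b) → a ≡ b
T-injective e = ⇔→≡ (⇔.trans (⇔.sym T-≡) (⇔.trans e T-≡))

T-not-∨ : ∀ {a b} → T (not a ∨ b) ⇔ (T a → T b)
T-not-∨ {true}  = mk⇔ (λ b _ → b) (λ a⇒b → a⇒b _)
T-not-∨ {false} = mk⇔ (λ _ ()) (λ _ → _)

T-all-allFin : ∀ {n} (p : Fin n → Bool) → T (all p (allFin n)) ⇔ (∀ i → T (p i))
T-all-allFin {n} p = mk⇔ (λ t i → All.lookup (all⁺ p (allFin n) t) (∈-allFin i))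
                          (λ ps → all⁻ p {allFin n} (All.tabulate (λ {i} _ → ps i)))

T-≈ᶠ : ∀ {n} {a b : Fin n} → T (a ≈ᶠ b) ⇔ a ≡ b
T-≈ᶠ = mk⇔ toWitness fromWitness

≈ᶠ-refl : ∀ {n} (a : Fin n) → T (a ≈ᶠ a)
≈ᶠ-refl a = from T-≈ᶠ refl

∈⇒lookup : ∀ {A : Set} {x : A} {xs} → x ∈ xs → Σ (Fin (length xs)) λ i → lookup xs i ≡ x
∈⇒lookup x∈xs = Any.index x∈xs , sym (lookup-index x∈xs)

T-≈ᶠ-pair : ∀ {n} {a b x y : Fin n} → T ((a ≈ᶠ x) ∧ (b ≈ᶠ y)) ⇔ (x , y) ≡ (a , b)
T-≈ᶠ-pair {a = a} {b} {x} {y} = mk⇔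
  (λ t → let a≡x , b≡y = to (T-∧ {a ≈ᶠ x}) t in cong₂ _,_ (sym (to T-≈ᶠ a≡x)) (sym (to T-≈ᶠ b≡y)))
  (λ { refl → from (T-∧ {a ≈ᶠ a}) (≈ᶠ-refl a , ≈ᶠ-refl b) })

hom≡∑ : (G H : Graph) → + hom G H ≡ ∑ (allFuns (V G) (V H)) (λ f → ⟦ isHom G H f ⟧)
hom≡∑ G H = count≡∑ (isHom G H) (allFuns (V G) (V H))

IsHom : (G H : Graph) → (Fin (V G) → Fin (V H)) → Set
IsHom G H f = ∀ u v → T (adj G u v) → T (adj H (f u) (f v))

isHom⇔IsHom : (G H : Graph) (f : Fin (V G) → Fin (V H)) → T (isHom G H f) ⇔ IsHom G H f
isHom⇔IsHom G H f = ⇔.trans (T-all-allFin _) (mk⇔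
  (λ t u v → to T-not-∨ (to (T-all-allFin _) (t u) v))
  (λ h u → from (T-all-allFin _) (λ v → from T-not-∨ (h u v))))

IsHom-resp-≗ : (G H : Graph) {f f′ : Fin (V G) → Fin (V H)} → f ≗ f′ → IsHom G H f → IsHom G H f′
IsHom-resp-≗ G H f≗f′ hom u v a = subst₂ (λ x y → T (adj H x y)) (f≗f′ u) (f≗f′ v) (hom u v a)

isHom-cong : (G H : Graph) {f f′ : Fin (V G) → Fin (V H)} → f ≗ f′ → isHom G H f ≡ isHom G H f′
isHom-cong G H f≗f′ = T-injective (⇔.trans (isHom⇔IsHom G H _) (⇔.trans
  (mk⇔ (IsHom-resp-≗ G H f≗f′) (IsHom-resp-≗ G H (sym ∘ f≗f′))) (⇔.sym (isHom⇔IsHom G H _))))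

record EdgeList (G : Graph) (L : List (Fin (V G) × Fin (V G))) : Set where
  field
    edge⇒adj : ∀ {u v} → (u , v) ∈ L → T (adj G u v)
    adj⇒edge : ∀ {u v} → T (adj G u v) → (u , v) ∈ L ⊎ (v , u) ∈ L

isHom-edgeList : ∀ {G L} → EdgeList G L → (H : Graph) → Symmetric H → (f : Fin (V G) → Fin (V H)) →
  isHom G H f ≡ all (λ e → adj H (f (proj₁ e)) (f (proj₂ e))) L
isHom-edgeList {G} {L} E H symH f = T-injective (⇔.trans (isHom⇔IsHom G H f) (mk⇔
  (λ hom → all⁻ _ (All.tabulate (λ {e} e∈L → hom (proj₁ e) (proj₂ e) (edge⇒adj e∈L))))
  (λ all-edges u v a → Sum.[ All.lookup (all⁺ _ L all-edges)
                           , (λ vu∈L → subst T (symH (f v) (f u)) (All.lookup (all⁺ _ L all-edges) vu∈L)) ]′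
                         (adj⇒edge a))))
  where open EdgeList E

hom≡∑-edgeList : ∀ {G L} → EdgeList G L → (H : Graph) → Symmetric H →
  + hom G H ≡ ∑ (allFuns (V G) (V H)) (λ f → ⟦ all (λ e → adj H (f (proj₁ e)) (f (proj₂ e))) L ⟧)
hom≡∑-edgeList {G} E H symH = trans (hom≡∑ G H)
  (∑-cong (allFuns (V G) (V H)) (cong ⟦_⟧ ∘ isHom-edgeList E H symH))

edges-edgeList : (G : Graph) → Symmetric G → Loopless G → EdgeList G (edges G)
edges-edgeList G symG loopG = record { edge⇒adj = edge⇒adj ; adj⇒edge = adj⇒edge }
  where
  n = V G
  forward : Fin n → Fin n → Bool
  forward u v = (toℕ u <ᵇ toℕ v) ∧ adj G u v

  edge⇒adj : ∀ {u v} → (u , v) ∈ edges G → T (adj G u v)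
  edge⇒adj uv∈E with Any.satisfied (∈-concatMap⁻ _ {xs = allFin n} uv∈E)
  ... | u′ , uv∈row with ∈-map⁻ (u′ ,_) uv∈row
  ... | v′ , v′∈ , refl = proj₂ (to T-∧ (proj₂ (∈-filter⁻ (T? ∘ forward u′) {xs = allFin n} v′∈)))

  forward⇒edge : ∀ {u v} → toℕ u < toℕ v → T (adj G u v) → (u , v) ∈ edges G
  forward⇒edge {u} {v} u<v a = ∈-concatMap⁺ _ {xs = allFin n}
    (lose (∈-allFin u) (∈-map⁺ (u ,_)
      (∈-filter⁺ (T? ∘ forward u) (∈-allFin v) (from T-∧ (ℕ.<⇒<ᵇ u<v , a)))))

  adj⇒edge : ∀ {u v} → T (adj G u v) → (u , v) ∈ edges G ⊎ (v , u) ∈ edges G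
  adj⇒edge {u} {v} a with <-cmp u v
  ... | tri< u<v _ _    = inj₁ (forward⇒edge u<v a)
  ... | tri≈ _ refl _   = ⊥-elim (subst T (loopG u) a)
  ... | tri> _ _ v<u    = inj₂ (forward⇒edge v<u (subst T (symG u v) a))

induced : (G : Graph) → List (Fin (V G)) → Graph
induced G W = onVertices (V G) (adj G) W

NoIsolated : Graph → Set
NoIsolated G = ∀ u → ∃ λ v → T (adj G u v)

dropIsolated : Graph → Graph
dropIsolated H = induced H (filterᵇ (λ w → any (adj H w) (allFin (V H))) (allFin (V H)))

complement : Graph → Graph
complement H = record { V = V H ; adj = λ u v → not (adj H u v) }

complement-symmetric : ∀ {H} → Symmetric H → Symmetric (complement H)
complement-symmetric symH u v = cong not (symH u v)

module _ (G H : Graph) (s : Fin (V G) → Bool) (closed : ∀ {u v} → T (adj G u v) → T (s u) × T (s v)) where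

  private
    W = filterᵇ s (allFin (V G))

    position : ∀ u → T (s u) → Σ (Fin (length W)) λ i → lookup W i ≡ u
    position u su = ∈⇒lookup (∈-filter⁺ (T? ∘ s) (∈-allFin u) su)

  isHom-induced : (f : Fin (V G) → Fin (V H)) (h : Fin (length W) → Fin (V H)) →
    (∀ i → f (lookup W i) ≡ h i) → isHom G H f ≡ isHom (induced G W) H h
  isHom-induced f h f∘W≗h = T-injective (⇔.trans (isHom⇔IsHom G H f) (⇔.trans (mk⇔ restrict extend)
    (⇔.sym (isHom⇔IsHom (induced G W) H h))))
    where
    restrict : IsHom G H f → IsHom (induced G W) H h
    restrict hom i j a = subst₂ (λ x y → T (adj H x y)) (f∘W≗h i) (f∘W≗h j) (hom _ _ a)
    extend : IsHom (induced G W) H h → IsHom G H f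
    extend hom u v a with position u (proj₁ (closed a)) | position v (proj₂ (closed a))
    ... | i , refl | j , refl = subst₂ (λ x y → T (adj H x y)) (sym (f∘W≗h i)) (sym (f∘W≗h j)) (hom i j a)

  hom-induced : hom G H ≡ V H ^ (V G ∸ length W) *ℕ hom (induced G W) H
  hom-induced with filter-thinning s (λ i → i)
  ... | ρ , W≗ρ = ℤ.+-injective (begin
    + hom G H                                                     ≡⟨ hom≡∑ G H ⟩
    ∑ (allFuns (V G) (V H)) (λ f → ⟦ isHom G H f ⟧)
      ≡⟨ ∑-allFuns-thin ρ _ _ (λ f h f∘ρ≗h →
           cong ⟦_⟧ (isHom-induced f h (λ i → trans (cong f (W≗ρ i)) (f∘ρ≗h i)))) ⟩
    + power * ∑ (allFuns (length W) (V H)) (λ h → ⟦ isHom (induced G W) H h ⟧)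
      ≡⟨ cong (_*_ (+ power)) (sym (hom≡∑ (induced G W) H)) ⟩
    + power * + hom (induced G W) H                                ≡⟨ sym (ℤ.pos-* power _) ⟩
    + (power *ℕ hom (induced G W) H)                               ∎)
    where
    open ≡-Reasoning
    power = V H ^ (V G ∸ length W)

hom-dropIsolated : (G H : Graph) → NoIsolated G → hom G H ≡ hom G (dropIsolated H)
hom-dropIsolated G H noIsolated = ℤ.+-injective (begin
  + hom G H                                                           ≡⟨ hom≡∑ G H ⟩
  ∑ (allFuns (V G) (V H)) (λ h → ⟦ isHom G H h ⟧)
    ≡⟨ ∑-allFuns-filter (V G) hasNeighbour _ _ isolated-value (λ h h′ h≗ → cong ⟦_⟧ (isHom-cong G H h≗)) ⟩
  ∑ (allFuns (V G) (V H′)) (λ h → ⟦ isHom G H′ h ⟧)                   ≡⟨ sym (hom≡∑ G H′) ⟩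
  + hom G H′                                                          ∎)
  where
  open ≡-Reasoning
  H′ = dropIsolated H
  hasNeighbour : Fin (V H) → Bool
  hasNeighbour w = any (adj H w) (allFin (V H))
  isolated-value : ∀ h i → hasNeighbour (h i) ≡ false → ⟦ isHom G H h ⟧ ≡ + 0
  isolated-value h i isolated = ⟦⟧-false λ t →
    let j , a = noIsolated i
    in subst T isolated (any⁺ _ (lose (∈-allFin (h j)) (to (isHom⇔IsHom G H h) t i j a)))

module _ {n : ℕ} (S : List (Fin n × Fin n)) where

  edgeGraph : Graph
  edgeGraph = record { V = n ; adj = inEdges S }

  inEdges⇔ : ∀ {u v} → T (inEdges S u v) ⇔ ((u , v) ∈ S ⊎ (v , u) ∈ S)
  inEdges⇔ {u} {v} = ⇔.trans (⇔.sym any⇔) (mk⇔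
    (Any-⊎⁻ ∘ Any.map (λ t → Sum.map (to T-≈ᶠ-pair) (to T-≈ᶠ-pair) (to T-∨ t)))
    (Any.map (λ uv≡e⊎vu≡e → from T-∨ (Sum.map (from T-≈ᶠ-pair) (from T-≈ᶠ-pair) uv≡e⊎vu≡e))
      ∘ Any-⊎⁺))

  edgeGraph-edgeList : EdgeList edgeGraph S
  edgeGraph-edgeList = record { edge⇒adj = from inEdges⇔ ∘ inj₁ ; adj⇒edge = to inEdges⇔ }

  touches : Fin n → Bool
  touches x = any (λ e → (proj₁ e ≈ᶠ x) ∨ (proj₂ e ≈ᶠ x)) S

  touches-endpoints : ∀ {u v} → (u , v) ∈ S → T (touches u) × T (touches v)
  touches-endpoints {u} {v} uv∈S =
    any⁺ _ (Any.map (λ { refl → from (T-∨ {u ≈ᶠ u}) (inj₁ (≈ᶠ-refl u)) }) uv∈S) ,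
    any⁺ _ (Any.map (λ { refl → from (T-∨ {u ≈ᶠ v}) (inj₂ (≈ᶠ-refl v)) }) uv∈S)

  touches⇒incident : ∀ {x} → T (touches x) → ∃ λ y → (x , y) ∈ S ⊎ (y , x) ∈ S
  touches⇒incident t with find (any⁻ _ S t)
  ... | (a , b) , ab∈S , a≈x∨b≈x with to T-∨ a≈x∨b≈x
  ... | inj₁ a≈x = b , inj₁ (subst (λ z → (z , b) ∈ S) (to T-≈ᶠ a≈x) ab∈S)
  ... | inj₂ b≈x = a , inj₂ (subst (λ z → (a , z) ∈ S) (to T-≈ᶠ b≈x) ab∈S)

  inEdges⇒touches : ∀ {u v} → T (inEdges S u v) → T (touches u) × T (touches v)
  inEdges⇒touches = Sum.[ touches-endpoints , swap ∘ touches-endpoints ]′ ∘ to inEdges⇔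

  spanned-noIsolated : NoIsolated (induced edgeGraph (spanned S))
  spanned-noIsolated i with touches⇒incident (proj₂ (∈-filter⁻ (T? ∘ touches) {xs = allFin n} (∈-lookup i)))
  ... | y , incident with ∈⇒lookup (∈-filter⁺ (T? ∘ touches) (∈-allFin y)
                                      (Sum.[ proj₂ ∘ touches-endpoints , proj₁ ∘ touches-endpoints ]′ incident))
  ... | j , refl = j , from inEdges⇔ incident

  hom-edgeGraph : (H : Graph) →
    hom edgeGraph H ≡ V H ^ (n ∸ length (spanned S)) *ℕ hom (induced edgeGraph (spanned S)) (dropIsolated H)
  hom-edgeGraph H = trans (hom-induced edgeGraph H touches inEdges⇒touches)
    (cong (_*ℕ_ (V H ^ (n ∸ length (spanned S)))) (hom-dropIsolated _ H spanned-noIsolated))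

*-pos-*-comm : (s : ℤ) (a b : ℕ) → s * + (a *ℕ b) ≡ s * + b * + a
*-pos-*-comm s a b = begin
  s * + (a *ℕ b)   ≡⟨ cong (_*_ s) (trans (ℤ.pos-* a b) (ℤ.*-comm (+ a) (+ b))) ⟩
  s * (+ b * + a)  ≡⟨ sym (ℤ.*-assoc s (+ b) (+ a)) ⟩
  s * + b * + a    ∎
  where open ≡-Reasoning

lemma1p3 : (G H : Graph) → Symmetric G → Loopless G → Symmetric H →
    + hom G H ≡
      sumℤ (map (λ S → ((- (+ 1)) ^ℤ length S) * (+ hom (GS G S) (Hc H)) * (+ (V H ^ (V G ∸ vS G S))))
                (subsets (edges G)))
lemma1p3 G H symG loopG symH = begin
  + hom G H
    ≡⟨ hom≡∑-edgeList (edges-edgeList G symG loopG) H symH ⟩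
  ∑ Maps (λ f → ⟦ all (preserves f) (edges G) ⟧)
    ≡⟨ ∑-cong Maps (λ f → InclusionExclusion.all≡∑-subsets (preserves f) (edges G)) ⟩
  ∑ Maps (λ f → ∑ Subsets (λ S → sign S * ⟦ all (not ∘ preserves f) S ⟧))
    ≡⟨ ∑-swap Maps Subsets _ ⟩
  ∑ Subsets (λ S → ∑ Maps (λ f → sign S * ⟦ all (not ∘ preserves f) S ⟧))
    ≡⟨ ∑-cong Subsets (λ S → ∑-*ˡ Maps (sign S) _) ⟩
  ∑ Subsets (λ S → sign S * ∑ Maps (λ f → ⟦ all (not ∘ preserves f) S ⟧))
    ≡⟨ ∑-cong Subsets (λ S → cong (_*_ (sign S))
         (sym (hom≡∑-edgeList (edgeGraph-edgeList S) (complement H) (complement-symmetric symH)))) ⟩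
  ∑ Subsets (λ S → sign S * + hom (edgeGraph S) (complement H))
    -- induced (edgeGraph S) (spanned S) unfolds to GS G S, and dropIsolated (complement H) to Hc H
    ≡⟨ ∑-cong Subsets (λ S → cong (λ k → sign S * + k) (hom-edgeGraph S (complement H))) ⟩
  ∑ Subsets (λ S → sign S * + (V H ^ (V G ∸ vS G S) *ℕ hom (GS G S) (Hc H)))
    ≡⟨ ∑-cong Subsets (λ S → *-pos-*-comm (sign S) (V H ^ (V G ∸ vS G S)) (hom (GS G S) (Hc H))) ⟩
  ∑ Subsets (λ S → sign S * + hom (GS G S) (Hc H) * + (V H ^ (V G ∸ vS G S))) ∎
  where
  open ≡-Reasoning
  Maps = allFuns (V G) (V H)
  Subsets = subsets (edges G)
  preserves : (Fin (V G) → Fin (V H)) → Fin (V G) × Fin (V G) → Bool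
  preserves f e = adj H (f (proj₁ e)) (f (proj₂ e))
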